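{- Let $n \ge 1$. Let $\mathcal H_{2n-1}$ be the real hyperplane arrangement in $\mathbb{R}^{2n+2}$ (coordinates $x_1,\dots,x_{n+1},y_1,\dots,y_{n+1}$) given by $$\mathcal{H}_{2n-1}= \{x_i - x_j = y_i : 1 \le i < j \le n+1\}.$$ Let $\Gamma_{2n}$ be the bipartite graph on vertex set $\{1,3,\dots,2n-1\}\sqcup\{2,4,\dots,2n\}$ in which $2i-1$ and $2j$ are adjacent if and only if $i \le j$. Then the intersection lattice $\mathcal L(\mathcal H_{2n-1})$ is isomorphic to the bond lattice $\Pi_{\Gamma_{2n}}$, and $\Pi_{\Gamma_{2n}}$ is equal to the induced subposet of the partition lattice $\Pi_{2n}$ consisting of those partitions $B_1|\cdots|B_k$ of $[2n]$ such that $\min(B_i)$ is odd and $\max(B_i)$ is even for every nonsingleton block $B_i$.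
   Context: The intersection poset $\mathcal L(\mathcal A)$ of a hyperplane arrangement $\mathcal A$ is the set of all nonempty intersections of subsets of hyperplanes of $\mathcal A$ (including the whole space as the empty intersection), ordered by reverse inclusion. $\Pi_{N}$ denotes the lattice of set partitions of $[N]=\{1,\dots,N\}$ ordered by refinement (coarser partitions are larger). For a graph $G$ on vertex set $[N]$, the bond lattice $\Pi_G$ is the subposet of $\Pi_N$ consisting of partitions $B_1|\cdots|B_k$ such that the induced subgraph $G|_{B_i}$ is connected for every $i$.
   Formalization: The arrangement $\mathcal H_{2n-1}$ is taken in ℚ^(2n+2) rather than in $\mathbb{R}^{2n+2}$, so its flats are sets of points with rational coordinates. -}

module Defs where

open import Data.Nat using (ℕ; suc; _+_; _*_; _∸_; _≤_; _<_)
open import Data.Fin using (Fin; toℕ)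
open import Data.Bool using (Bool; true)
open import Data.Rational using (ℚ; _-_)
open import Data.Product using (Σ; ∃; _×_; _,_)
open import Data.Sum using (_⊎_)
open import Relation.Binary.PropositionalEquality using (_≡_)
open import Function.Bundles using (_⇔_)

Odd : ℕ → Set
Odd m = ∃ λ k → m ≡ 2 * k + 1

Even : ℕ → Set
Even m = ∃ λ k → m ≡ 2 * k

-- Vertex k : Fin N stands for the element  lab k = toℕ k + 1  of [N].
lab : ∀ {N} → Fin N → ℕ
lab k = suc (toℕ k)

-- A partition is given by a block-labelling f : Fin N → Fin N; the blocks
-- are the nonempty fibres of f.  Two labellings denote the same partition
-- iff they have the same kernel.

Partition : ℕ → Set
Partition N = Fin N → Fin N

SameBlock : ∀ {N} → Partition N → Fin N → Fin N → Set
SameBlock f i j = f i ≡ f j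

_≈Π_ : ∀ {N} → Partition N → Partition N → Set
f ≈Π g = ∀ i j → SameBlock f i j ⇔ SameBlock g i j

_≤Π_ : ∀ {N} → Partition N → Partition N → Set
f ≤Π g = ∀ i j → SameBlock f i j → SameBlock g i j

Graph : ℕ → Set₁
Graph N = Fin N → Fin N → Set

data Walk {N} (G : Graph N) (P : Fin N → Set) : Fin N → Fin N → Set where
  here : ∀ {i} → P i → Walk G P i i
  step : ∀ {i j k} → P i → G i j → Walk G P j k → Walk G P i k

BlockConnected : ∀ {N} → Graph N → Partition N → Fin N → Set
BlockConnected G f i = ∀ j k → SameBlock f i j → SameBlock f i k →
                       Walk G (SameBlock f i) j k

IsBond : ∀ {N} → Graph N → Partition N → Set
IsBond G f = ∀ i → BlockConnected G f i

BondLattice : ∀ {N} → Graph N → Set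
BondLattice {N} G = Σ (Partition N) (IsBond G)

ΓEdge : (n : ℕ) → Fin (2 * n) → Fin (2 * n) → Set
ΓEdge n u v = Σ ℕ λ i → Σ ℕ λ j →
  1 ≤ i × i ≤ j × j ≤ n × lab u ≡ 2 * i ∸ 1 × lab v ≡ 2 * j

Γ : (n : ℕ) → Graph (2 * n)
Γ n u v = ΓEdge n u v ⊎ ΓEdge n v u

NonSingletonBlock : ∀ {N} → Partition N → Fin N → Set
NonSingletonBlock f i = Σ _ λ j → SameBlock f i j × (toℕ i ≡ toℕ j → Data.Empty.⊥)
  where import Data.Empty

IsMinOfBlock : ∀ {N} → Partition N → Fin N → Fin N → Set
IsMinOfBlock f i m = SameBlock f i m × (∀ j → SameBlock f i j → toℕ m ≤ toℕ j)

IsMaxOfBlock : ∀ {N} → Partition N → Fin N → Fin N → Set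
IsMaxOfBlock f i m = SameBlock f i m × (∀ j → SameBlock f i j → toℕ j ≤ toℕ m)

MinOddMaxEven : ∀ {N} → Partition N → Set
MinOddMaxEven f = ∀ i → NonSingletonBlock f i →
  (∀ m → IsMinOfBlock f i m → Odd (lab m)) ×
  (∀ m → IsMaxOfBlock f i m → Even (lab m))

Point : ℕ → Set
Point n = (Fin (suc n) → ℚ) × (Fin (suc n) → ℚ)

OnHyp : ∀ {n} → Fin (suc n) → Fin (suc n) → Point n → Set
OnHyp i j (x , y) = x i - x j ≡ y i

-- a subset S of H_{2n-1}: H_{ij} (i<j) belongs to S iff S i j ≡ true
HypSubset : ℕ → Set
HypSubset n = Fin (suc n) → Fin (suc n) → Bool

InInter : ∀ {n} → HypSubset n → Point n → Set
InInter S p = ∀ i j → toℕ i < toℕ j → S i j ≡ true → OnHyp i j p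

-- elements of L(H_{2n-1}): nonempty intersections, presented by a subset S
Flat : ℕ → Set
Flat n = Σ (HypSubset n) λ S → ∃ λ p → InInter S p

_≈L_ : ∀ {n} → Flat n → Flat n → Set
(S , _) ≈L (T , _) = ∀ p → InInter S p ⇔ InInter T p

_≤L_ : ∀ {n} → Flat n → Flat n → Set
(S , _) ≤L (T , _) = ∀ p → InInter T p → InInter S p

record PosetIso {A B : Set}
  (_≈A_ _≤A_ : A → A → Set) (_≈B_ _≤B_ : B → B → Set) : Set where
  field
    to          : A → B
    to-cong     : ∀ {a a'} → a ≈A a' → to a ≈B to a'
    to-mono     : ∀ {a a'} → a ≤A a' → to a ≤B to a'
    to-reflect  : ∀ {a a'} → to a ≤B to a' → a ≤A a'
    to-surj     : ∀ b → ∃ λ a → to a ≈B b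

_≈Γ_ : ∀ {n} → BondLattice (Γ n) → BondLattice (Γ n) → Set
(f , _) ≈Γ (g , _) = f ≈Π g

_≤Γ_ : ∀ {n} → BondLattice (Γ n) → BondLattice (Γ n) → Set
(f , _) ≤Γ (g , _) = f ≤Π g

module Submission where

-- Part 1 is a change of coordinates followed by the classical description of a
-- graphic arrangement.  Attach to the vertex labelled 2k+1 the linear form
-- x_k - y_k and to the vertex labelled 2k the form x_k.  The resulting map
-- coord : Q^{2n+2} → Q^{2n} is surjective, and H_ij (i < j) becomes the
-- hyperplane "coordinates 2i+1 and 2j agree", i.e. the graphic hyperplane of an
-- edge of Γ_{2n}; every edge of Γ_{2n} arises this way.  For a graph given by an
-- edge list, two vertices lie in the same connected component iff every
-- function respecting the edges agrees on them (an indicator vector separates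
-- distinct components).
--
-- Part 2 only uses that Γ_{2n} joins an odd-labelled vertex to every later
-- even-labelled one: the least element of a connected block must be the odd
-- end of its first edge, the greatest the even end, and conversely a block with
-- odd minimum m and even maximum M is connected through m and M.

open import Defs
open import Data.Nat using (ℕ; _≤_; _*_)
open import Data.Product using (_×_)
open import Function.Bundles using (_⇔_)

open import Data.Nat using (zero; suc; _+_; _∸_; _<_; z≤n; s≤s; _<?_; _≟_)
open import Data.Nat.Properties
  using (+-comm; *-suc; *-cancelˡ-≤; *-cancelˡ-<; *-monoʳ-≤; ≤-trans; <-≤-trans;
         <⇒≤; <⇒≱; ≤-reflexive; m≤n+m; m<n⇒m<1+n; suc-injective; ≤-pred)
open import Data.Fin using (Fin; zero; suc; toℕ; fromℕ<) renaming (_≟_ to _≟F_)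
open import Data.Fin.Properties using (toℕ-injective; toℕ<n; toℕ-fromℕ<)
open import Data.Rational using (ℚ; 0ℚ; 1ℚ; _-_; -_) renaming (_+_ to _+ℚ_)
open import Data.Rational.Properties
  using (neg-distrib-+; +-inverseʳ; +-assoc; +-identityˡ; +-*-ring)
open import Algebra.Properties.Ring +-*-ring using (-‿involutive)
open import Data.Bool using (true; false; if_then_else_)
open import Data.Maybe using (Maybe; just; nothing)
open import Data.List using (List; []; _∷_; mapMaybe; cartesianProduct; allFin)
open import Data.List.Membership.Propositional using (_∈_)
open import Data.List.Membership.Propositional.Properties using (∈-cartesianProduct⁺; ∈-allFin)
open import Data.List.Relation.Unary.Any using (here; there)
open import Data.Product using (Σ; ∃; ∃₂; _,_; proj₁; proj₂)
open import Data.Sum using (_⊎_; inj₁; inj₂)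
open import Data.Unit using (⊤; tt)
open import Data.Empty using (⊥-elim)
open import Function using (_∘_; id)
open import Function.Bundles using (mk⇔; Equivalence)
open import Relation.Nullary using (¬_; Dec; yes; no; does)
open import Relation.Nullary.Decidable using (dec-true; dec-false)
open import Relation.Binary.PropositionalEquality
  using (_≡_; _≢_; refl; sym; trans; cong; cong₂; subst; subst₂; module ≡-Reasoning)

open Equivalence using (to; from)

suc-odd : ∀ k → suc (2 * k + 1) ≡ 2 * suc k
suc-odd k = trans (cong suc (+-comm (2 * k) 1)) (sym (*-suc 2 k))

-- the label 2i-1 used in the definition of Γ is 2(i-1)+1
pred-double : ∀ k → 2 * suc k ∸ 1 ≡ 2 * k + 1
pred-double k = trans (cong (_∸ 1) (*-suc 2 k)) (+-comm 1 (2 * k))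

parity : ∀ m → Even m ⊎ Odd m
parity zero = inj₁ (0 , refl)
parity (suc m) with parity m
... | inj₁ (k , m≡2k)   = inj₂ (k , trans (cong suc m≡2k) (+-comm 1 (2 * k)))
... | inj₂ (k , m≡2k+1) = inj₁ (suc k , trans (cong suc m≡2k+1) (suc-odd k))

odd<even⇔ : ∀ p q → 2 * p + 1 < 2 * q ⇔ p < q
odd<even⇔ p q = mk⇔
  (λ lt → *-cancelˡ-≤ 2 (subst (_≤ 2 * q) (suc-odd p) lt))
  (λ lt → subst (_≤ 2 * q) (sym (suc-odd p)) (*-monoʳ-≤ 2 lt))

-- an odd number is never equal to an even one, so if it is at most an even
-- number its half is smaller
odd≤even⇒< : ∀ p q → 2 * p + 1 ≤ 2 * q → p < q
odd≤even⇒< p q le = *-cancelˡ-< 2 p q (<-≤-trans (≤-reflexive (+-comm 1 (2 * p))) le)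

lab-injective : ∀ {N} {a b : Fin N} → lab a ≡ lab b → a ≡ b
lab-injective = toℕ-injective ∘ suc-injective

lab<⇒toℕ< : ∀ {N} {a b : Fin N} → lab a < lab b → toℕ a < toℕ b
lab<⇒toℕ< = ≤-pred

halves< : ∀ {N} {a b : Fin N} {p q} → lab a ≡ 2 * p + 1 → lab b ≡ 2 * q → p < q → toℕ a < toℕ b
halves< {p = p} {q} a≡2p+1 b≡2q p<q =
  lab<⇒toℕ< (subst₂ _<_ (sym a≡2p+1) (sym b≡2q) (from (odd<even⇔ p q) p<q))

vertexWithLabel : ∀ {N} ℓ → 1 ≤ ℓ → ℓ ≤ N → Σ (Fin N) λ a → lab a ≡ ℓ
vertexWithLabel (suc t) _ t<N = fromℕ< t<N , cong suc (toℕ-fromℕ< t<N)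

module _ {N : ℕ} {G : Graph N} {P : Fin N → Set} where

  walkHead : ∀ {a b} → Walk G P a b → P a
  walkHead (here pa)     = pa
  walkHead (step pa _ _) = pa

  infixr 5 _++ʷ_

  _++ʷ_ : ∀ {a b c} → Walk G P a b → Walk G P b c → Walk G P a c
  here _       ++ʷ w' = w'
  step pa e w  ++ʷ w' = step pa e (w ++ʷ w')

  reverse : (∀ {a b} → G a b → G b a) → ∀ {a b} → Walk G P a b → Walk G P b a
  reverse G-sym (here pa)     = here pa
  reverse G-sym (step pa e w) = reverse G-sym w ++ʷ step (walkHead w) (G-sym e) (here pa)

  firstStep : ∀ {a b} → Walk G P a b → toℕ a ≢ toℕ b → Σ (Fin N) λ k → P k × G a k
  firstStep (here _)     a≢b = ⊥-elim (a≢b refl)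
  firstStep (step _ e w) _   = _ , walkHead w , e

  walk-invariant : ∀ {A : Set} (h : Fin N → A) →
    (∀ {a b} → P a → P b → G a b → h a ≡ h b) →
    ∀ {a b} → Walk G P a b → h a ≡ h b
  walk-invariant h inv (here _)      = refl
  walk-invariant h inv (step pa e w) = trans (inv pa (walkHead w) e) (walk-invariant h inv w)

  walk-transport : ∀ {H : Graph N} {Q : Fin N → Set} →
    (∀ {a b} → G a b → H a b) → (∀ {a b} → G a b → Q a → Q b) →
    ∀ {a b} → Q a → Walk G P a b → Walk H Q a b
  walk-transport G⊆H closed qa (here _)     = here qa
  walk-transport G⊆H closed qa (step _ e w) =
    step qa (G⊆H e) (walk-transport G⊆H closed (closed e qa) w)

Least Greatest : ∀ {N} → (Fin N → Set) → Fin N → Set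
Least    P m = P m × (∀ j → P j → toℕ m ≤ toℕ j)
Greatest P m = P m × (∀ j → P j → toℕ j ≤ toℕ m)

least? : ∀ {N} {P : Fin N → Set} → (∀ w → Dec (P w)) →
         Σ (Fin N) (Least P) ⊎ (∀ j → ¬ P j)
least? {zero}  P? = inj₂ λ ()
least? {suc N} P? with P? zero
... | yes p₀ = inj₁ (zero , p₀ , λ _ _ → z≤n)
... | no ¬p₀ with least? (P? ∘ suc)
...   | inj₁ (m , pm , m-least) =
          inj₁ (suc m , pm , λ { zero p₀ → ⊥-elim (¬p₀ p₀) ; (suc j) pj → s≤s (m-least j pj) })
...   | inj₂ none = inj₂ λ { zero → ¬p₀ ; (suc j) → none j }

greatest? : ∀ {N} {P : Fin N → Set} → (∀ w → Dec (P w)) →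
            Σ (Fin N) (Greatest P) ⊎ (∀ j → ¬ P j)
greatest? {zero}  P? = inj₂ λ ()
greatest? {suc N} P? with greatest? (P? ∘ suc)
... | inj₁ (m , pm , m-greatest) =
        inj₁ (suc m , pm , λ { zero _ → z≤n ; (suc j) pj → s≤s (m-greatest j pj) })
... | inj₂ none with P? zero
...   | yes p₀ = inj₁ (zero , p₀ , λ { zero _ → z≤n ; (suc j) pj → ⊥-elim (none j pj) })
...   | no ¬p₀ = inj₂ λ { zero → ¬p₀ ; (suc j) → none j }

module _ {N : ℕ} {P : Fin N → Set} (P? : ∀ w → Dec (P w)) {x : Fin N} (px : P x) where

  least : Σ (Fin N) (Least P)
  least with least? P?
  ... | inj₁ m    = m
  ... | inj₂ none = ⊥-elim (none x px)

  greatest : Σ (Fin N) (Greatest P)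
  greatest with greatest? P?
  ... | inj₁ m    = m
  ... | inj₂ none = ⊥-elim (none x px)

module _ {n : ℕ} where

  ΓEdge⇔ : ∀ {a b : Fin (2 * n)} → ΓEdge n a b ⇔ (Odd (lab a) × Even (lab b) × toℕ a < toℕ b)
  ΓEdge⇔ {a} {b} = mk⇔ decode encode
    where
    decode : ΓEdge n a b → Odd (lab a) × Even (lab b) × toℕ a < toℕ b
    decode (suc i , j , _ , i≤j , _ , a≡2i+1 , b≡2j) =
      (i , a-odd) , (j , b≡2j) , halves< a-odd b≡2j i≤j
      where
      a-odd : lab a ≡ 2 * i + 1
      a-odd = trans a≡2i+1 (pred-double i)
    encode : Odd (lab a) × Even (lab b) × toℕ a < toℕ b → ΓEdge n a b
    encode ((p , a≡2p+1) , (q , b≡2q) , a<b) =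
      suc p , q , s≤s z≤n , p<q , q≤n , trans a≡2p+1 (sym (pred-double p)) , b≡2q
      where
      p<q : p < q
      p<q = to (odd<even⇔ p q) (subst₂ _<_ a≡2p+1 b≡2q (s≤s a<b))
      q≤n : q ≤ n
      q≤n = *-cancelˡ-≤ 2 (subst (_≤ 2 * n) b≡2q (toℕ<n b))

  Γ-sym : ∀ {a b} → Γ n a b → Γ n b a
  Γ-sym (inj₁ e) = inj₂ e
  Γ-sym (inj₂ e) = inj₁ e

  halvesEdge : ∀ {a b p q} → lab a ≡ 2 * p + 1 → lab b ≡ 2 * q → p < q → ΓEdge n a b
  halvesEdge {p = p} {q} a≡2p+1 b≡2q p<q =
    from ΓEdge⇔ ((p , a≡2p+1) , (q , b≡2q) , halves< a≡2p+1 b≡2q p<q)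

  adjacent : ∀ {a b} → Odd (lab a) → Even (lab b) → toℕ a ≤ toℕ b → Γ n a b
  adjacent (p , a≡2p+1) (q , b≡2q) a≤b =
    inj₁ (halvesEdge a≡2p+1 b≡2q (odd≤even⇒< p q (subst₂ _≤_ a≡2p+1 b≡2q (s≤s a≤b))))

module _ {n : ℕ} (f : Partition (2 * n)) where

  inBlock? : ∀ i w → Dec (SameBlock f i w)
  inBlock? i w = f i ≟F f w

  -- in a connected block the least vertex starts an edge and the greatest ends one
  bond⇒minOddMaxEven : IsBond (Γ n) f → MinOddMaxEven f
  bond⇒minOddMaxEven bond i (j , ij , i≢j) = min-odd , max-even
    where
    another : ∀ m → Σ (Fin (2 * n)) λ w → SameBlock f i w × toℕ m ≢ toℕ w
    another m with toℕ m ≟ toℕ i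
    ... | yes m≡i = j , ij , λ m≡j → i≢j (trans (sym m≡i) m≡j)
    ... | no m≢i  = i , refl , m≢i

    neighbour : ∀ m → SameBlock f i m → Σ (Fin (2 * n)) λ k → SameBlock f i k × Γ n m k
    neighbour m im with another m
    ... | w , iw , m≢w = firstStep (bond i m w im iw) m≢w

    -- the neighbour of the least vertex lies after it, so the least vertex is odd
    min-odd : ∀ m → IsMinOfBlock f i m → Odd (lab m)
    min-odd m (im , m-least) with neighbour m im
    ... | k , ik , inj₁ m→k = proj₁ (to ΓEdge⇔ m→k)
    ... | k , ik , inj₂ k→m = ⊥-elim (<⇒≱ (proj₂ (proj₂ (to ΓEdge⇔ k→m))) (m-least k ik))

    max-even : ∀ m → IsMaxOfBlock f i m → Even (lab m)
    max-even m (im , m-greatest) with neighbour m im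
    ... | k , ik , inj₁ m→k = ⊥-elim (<⇒≱ (proj₂ (proj₂ (to ΓEdge⇔ m→k))) (m-greatest k ik))
    ... | k , ik , inj₂ k→m = proj₁ (proj₂ (to ΓEdge⇔ k→m))

  minOddMaxEven⇒bond : MinOddMaxEven f → IsBond (Γ n) f
  minOddMaxEven⇒bond min-max i j k ij ik with j ≟F k
  ... | yes refl = here ij
  ... | no j≢k with least (inBlock? i) {i} refl | greatest (inBlock? i) {i} refl
  ...   | m , im , m-least | M , iM , M-greatest = toMax j ij ++ʷ reverse Γ-sym (toMax k ik)
    where
    Block : Fin (2 * n) → Set
    Block = SameBlock f i

    nonsingleton : NonSingletonBlock f i
    nonsingleton with i ≟F j
    ... | yes refl = k , ik , j≢k ∘ toℕ-injective
    ... | no i≢j   = j , ij , i≢j ∘ toℕ-injective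

    m-odd : Odd (lab m)
    m-odd = proj₁ (min-max i nonsingleton) m (im , m-least)
    M-even : Even (lab M)
    M-even = proj₂ (min-max i nonsingleton) M (iM , M-greatest)

    -- odd vertices are adjacent to M, even ones to m, and m is adjacent to M
    toMax : ∀ x → Block x → Walk (Γ n) Block x M
    toMax x ix with parity (lab x)
    ... | inj₂ x-odd  = step ix (adjacent x-odd M-even (M-greatest x ix)) (here iM)
    ... | inj₁ x-even = step ix (Γ-sym (adjacent m-odd x-even (m-least x ix)))
                          (step im (adjacent m-odd M-even (m-least M iM)) (here iM))

  bond⇔minOddMaxEven : IsBond (Γ n) f ⇔ MinOddMaxEven f
  bond⇔minOddMaxEven = mk⇔ bond⇒minOddMaxEven minOddMaxEven⇒bond

module _ {A B : Set} (g : A → Maybe B) where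

  ∈-mapMaybe⁺ : ∀ {x y} xs → x ∈ xs → g x ≡ just y → y ∈ mapMaybe g xs
  ∈-mapMaybe⁺ (x ∷ xs) (here refl) gx≡y with g x
  ∈-mapMaybe⁺ (x ∷ xs) (here refl) refl | just _ = here refl
  ∈-mapMaybe⁺ (x ∷ xs) (there x∈) gx≡y with g x
  ... | nothing = ∈-mapMaybe⁺ xs x∈ gx≡y
  ... | just _  = there (∈-mapMaybe⁺ xs x∈ gx≡y)

  ∈-mapMaybe⁻ : ∀ {y} xs → y ∈ mapMaybe g xs → ∃ λ x → x ∈ xs × g x ≡ just y
  ∈-mapMaybe⁻ (x ∷ xs) y∈ with g x in gx
  ... | nothing = let x' , x'∈ , gx' = ∈-mapMaybe⁻ xs y∈ in x' , there x'∈ , gx'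
  ∈-mapMaybe⁻ (x ∷ xs) (here refl) | just _ = x , here refl , gx
  ∈-mapMaybe⁻ (x ∷ xs) (there y∈)  | just _ =
    let x' , x'∈ , gx' = ∈-mapMaybe⁻ xs y∈ in x' , there x'∈ , gx'

module _ {N : ℕ} where

  Edges : Set
  Edges = List (Fin N × Fin N)

  Adj : Edges → Graph N
  Adj L a b = (a , b) ∈ L ⊎ (b , a) ∈ L

  Linked : Edges → Fin N → Fin N → Set
  Linked L = Walk (Adj L) (λ _ → ⊤)

  merge : (Fin N → Fin N) → Fin N × Fin N → Fin N → Fin N
  merge c (a , b) w = if does (c w ≟F c b) then c a else c w

  component : Edges → Fin N → Fin N
  component []      = id
  component (e ∷ L) = merge (component L) e

  merge-respects : ∀ c e {u v} → c u ≡ c v → merge c e u ≡ merge c e v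
  merge-respects c e c[u]≡c[v] rewrite c[u]≡c[v] = refl

  merge-joins : ∀ c a b → merge c (a , b) a ≡ merge c (a , b) b
  merge-joins c a b rewrite dec-true (c b ≟F c b) refl with c a ≟F c b
  ... | yes c[a]≡c[b] = refl
  ... | no _          = refl

  component-edge : ∀ L {a b} → (a , b) ∈ L → component L a ≡ component L b
  component-edge (e ∷ L) (here refl) = merge-joins (component L) _ _
  component-edge (e ∷ L) (there ab)  = merge-respects (component L) e (component-edge L ab)

  component-adj : ∀ L {a b} → Adj L a b → component L a ≡ component L b
  component-adj L (inj₁ ab) = component-edge L ab
  component-adj L (inj₂ ba) = sym (component-edge L ba)

  weaken : ∀ {L e x y} → Linked L x y → Linked (e ∷ L) x y
  weaken = walk-transport (λ { (inj₁ xy) → inj₁ (there xy) ; (inj₂ yx) → inj₂ (there yx) }) _ tt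

  component-linked : ∀ L u v → component L u ≡ component L v → Linked L u v
  component-linked []            u v refl = here tt
  component-linked ((a , b) ∷ L) u v same
    with component L u ≟F component L b | component L v ≟F component L b
  ... | yes u~b | yes v~b = weaken (component-linked L u v (trans u~b (sym v~b)))
  ... | no _    | no _    = weaken (component-linked L u v same)
  ... | yes u~b | no _    = weaken (component-linked L u b u~b)
                         ++ʷ step tt (inj₂ (here refl)) (here tt)
                         ++ʷ weaken (component-linked L a v same)
  ... | no _    | yes v~b = weaken (component-linked L u a same)
                         ++ʷ step tt (inj₁ (here refl)) (here tt)
                         ++ʷ weaken (component-linked L b v (sym v~b))

  Respects : Edges → (Fin N → ℚ) → Set
  Respects L z = ∀ {a b} → (a , b) ∈ L → z a ≡ z b

  sameComponent⇔ : ∀ L u v →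
    component L u ≡ component L v ⇔ (∀ z → Respects L z → z u ≡ z v)
  sameComponent⇔ L u v = mk⇔ respected separated
    where
    open ≡-Reasoning

    respected : component L u ≡ component L v → ∀ z → Respects L z → z u ≡ z v
    respected same z z-respects =
      walk-invariant z (λ { _ _ (inj₁ ab) → z-respects ab ; _ _ (inj₂ ba) → sym (z-respects ba) })
        (component-linked L u v same)

    -- the indicator of the component of u respects L and separates it
    indicator : Fin N → ℚ
    indicator w = if does (component L w ≟F component L u) then 1ℚ else 0ℚ

    indicator-respects : Respects L indicator
    indicator-respects ab =
      cong (λ c → if does (c ≟F component L u) then 1ℚ else 0ℚ) (component-edge L ab)

    1≢0 : 1ℚ ≢ 0ℚ
    1≢0 ()

    separated : (∀ z → Respects L z → z u ≡ z v) → component L u ≡ component L v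
    separated agree with component L v ≟F component L u
    ... | yes v~u = sym v~u
    ... | no v≁u  = ⊥-elim (1≢0 (begin
          1ℚ          ≡⟨ cong (if_then 1ℚ else 0ℚ) (sym (dec-true (_ ≟F component L u) refl)) ⟩
          indicator u ≡⟨ agree indicator indicator-respects ⟩
          indicator v ≡⟨ cong (if_then 1ℚ else 0ℚ) (dec-false (_ ≟F component L u) v≁u) ⟩
          0ℚ          ∎))

x-[x-z]≡z : ∀ x z → x - (x - z) ≡ z
x-[x-z]≡z x z = begin
  x +ℚ - (x +ℚ - z)    ≡⟨ cong (x +ℚ_) (neg-distrib-+ x (- z)) ⟩
  x +ℚ (- x +ℚ - - z)  ≡⟨ sym (+-assoc x (- x) (- - z)) ⟩
  (x +ℚ - x) +ℚ - - z  ≡⟨ cong₂ _+ℚ_ (+-inverseʳ x) (-‿involutive z) ⟩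
  0ℚ +ℚ z              ≡⟨ +-identityˡ z ⟩
  z                    ∎
  where open ≡-Reasoning

minus-swap : ∀ x {y z} → x - y ≡ z → x - z ≡ y
minus-swap x {y} x-y≡z = trans (cong (λ t → x - t) (sym x-y≡z)) (x-[x-z]≡z x y)

extend : ∀ {N} {A : Set} → (Fin N → A) → A → ℕ → A
extend {N} f d k with k <? N
... | yes k<N = f (fromℕ< k<N)
... | no _    = d

extend-toℕ : ∀ {N} {A : Set} (f : Fin N → A) d i → extend f d (toℕ i) ≡ f i
extend-toℕ {N} f d i with toℕ i <? N
... | yes i<N = cong f (toℕ-injective (toℕ-fromℕ< i<N))
... | no i≮N  = ⊥-elim (i≮N (toℕ<n i))

extend-restrict : ∀ {N} {A : Set} (F : ℕ → A) d {k} → k < N → extend {N} (F ∘ toℕ) d k ≡ F k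
extend-restrict {N} F d {k} k<N with k <? N
... | yes k<N' = cong F (toℕ-fromℕ< k<N')
... | no k≮N   = ⊥-elim (k≮N k<N)

byLabel : (ℕ → ℚ) → (ℕ → ℚ) → ℕ → ℚ
byLabel X Y zero          = X 0
byLabel X Y (suc zero)    = X 0 - Y 0
byLabel X Y (suc (suc ℓ)) = byLabel (X ∘ suc) (Y ∘ suc) ℓ

byLabel-even : ∀ X Y k → byLabel X Y (2 * k) ≡ X k
byLabel-even X Y zero    = refl
byLabel-even X Y (suc k) =
  trans (cong (byLabel X Y) (*-suc 2 k)) (byLabel-even (X ∘ suc) (Y ∘ suc) k)

byLabel-odd : ∀ X Y k → byLabel X Y (2 * k + 1) ≡ X k - Y k
byLabel-odd X Y zero    = refl
byLabel-odd X Y (suc k) =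
  trans (cong (λ ℓ → byLabel X Y (ℓ + 1)) (*-suc 2 k)) (byLabel-odd (X ∘ suc) (Y ∘ suc) k)

module Arrangement (n : ℕ) where

  V : Set
  V = Fin (2 * n)

  coord : Point n → V → ℚ
  coord (x , y) w = byLabel (extend x 0ℚ) (extend y 0ℚ) (lab w)

  coord-odd : ∀ x y {i a} → lab a ≡ 2 * toℕ i + 1 → coord (x , y) a ≡ x i - y i
  coord-odd x y {i} a≡2i+1 =
    trans (cong (byLabel (extend x 0ℚ) (extend y 0ℚ)) a≡2i+1)
      (trans (byLabel-odd (extend x 0ℚ) (extend y 0ℚ) (toℕ i))
        (cong₂ _-_ (extend-toℕ x 0ℚ i) (extend-toℕ y 0ℚ i)))

  coord-even : ∀ x y {j b} → lab b ≡ 2 * toℕ j → coord (x , y) b ≡ x j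
  coord-even x y {j} b≡2j =
    trans (cong (byLabel (extend x 0ℚ) (extend y 0ℚ)) b≡2j)
      (trans (byLabel-even (extend x 0ℚ) (extend y 0ℚ) (toℕ j)) (extend-toℕ x 0ℚ j))

  atLabel : (V → ℚ) → ℕ → ℚ
  atLabel z ℓ = extend z 0ℚ (ℓ ∸ 1)

  pointWith : (V → ℚ) → Point n
  pointWith z = (λ i → atLabel z (2 * toℕ i)) ,
                (λ i → atLabel z (2 * toℕ i) - atLabel z (2 * toℕ i + 1))

  module _ (z : V → ℚ) where
    open ≡-Reasoning

    private
      X X' Y' : ℕ → ℚ
      X k = atLabel z (2 * k)
      X'  = extend (proj₁ (pointWith z)) 0ℚ
      Y'  = extend (proj₂ (pointWith z)) 0ℚ

    coord-pointWith : ∀ w → coord (pointWith z) w ≡ z w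
    coord-pointWith w with parity (lab w)
    ... | inj₁ (k , w≡2k) = begin
      coord (pointWith z) w       ≡⟨ cong (byLabel X' Y') w≡2k ⟩
      byLabel X' Y' (2 * k)       ≡⟨ byLabel-even X' Y' k ⟩
      X' k                        ≡⟨ extend-restrict X 0ℚ k<1+n ⟩
      atLabel z (2 * k)           ≡⟨ cong (atLabel z) (sym w≡2k) ⟩
      atLabel z (lab w)           ≡⟨ extend-toℕ z 0ℚ w ⟩
      z w                         ∎
      where
      k<1+n : k < suc n
      k<1+n = s≤s (*-cancelˡ-≤ 2 (subst (_≤ 2 * n) w≡2k (toℕ<n w)))
    ... | inj₂ (k , w≡2k+1) = begin
      coord (pointWith z) w       ≡⟨ cong (byLabel X' Y') w≡2k+1 ⟩
      byLabel X' Y' (2 * k + 1)   ≡⟨ byLabel-odd X' Y' k ⟩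
      X' k - Y' k                 ≡⟨ cong₂ _-_ (extend-restrict X 0ℚ k<1+n)
                                      (extend-restrict (λ k → X k - atLabel z (2 * k + 1)) 0ℚ k<1+n) ⟩
      X k - (X k - atLabel z (2 * k + 1)) ≡⟨ x-[x-z]≡z (X k) (atLabel z (2 * k + 1)) ⟩
      atLabel z (2 * k + 1)       ≡⟨ cong (atLabel z) (sym w≡2k+1) ⟩
      atLabel z (lab w)           ≡⟨ extend-toℕ z 0ℚ w ⟩
      z w                         ∎
      where
      k<1+n : k < suc n
      k<1+n = m<n⇒m<1+n (odd≤even⇒< k n (subst (_≤ 2 * n) w≡2k+1 (toℕ<n w)))

  HypEdge : Fin (suc n) → Fin (suc n) → V → V → Set
  HypEdge i j a b = toℕ i < toℕ j × lab a ≡ 2 * toℕ i + 1 × lab b ≡ 2 * toℕ j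

  onHyp⇔ : ∀ {i j a b} → HypEdge i j a b →
           ∀ x y → OnHyp i j (x , y) ⇔ coord (x , y) a ≡ coord (x , y) b
  onHyp⇔ {i} {j} (_ , a≡2i+1 , b≡2j) x y = mk⇔
    (λ on → trans (coord-odd x y {i} a≡2i+1)
              (trans (minus-swap (x i) on) (sym (coord-even x y {j} b≡2j))))
    (λ eq → minus-swap (x i)
              (trans (sym (coord-odd x y {i} a≡2i+1)) (trans eq (coord-even x y {j} b≡2j))))

  hypEdge : ∀ {i j} → toℕ i < toℕ j → Σ (V × V) λ (a , b) → HypEdge i j a b
  hypEdge {i} {j} i<j with vertexWithLabel (2 * toℕ i + 1) (m≤n+m 1 _) (<⇒≤ 2i+1<2n)
                         | vertexWithLabel (2 * toℕ j) (≤-trans (m≤n+m 1 _) (<⇒≤ 2i+1<2j)) 2j≤2n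
    where
    2j≤2n : 2 * toℕ j ≤ 2 * n
    2j≤2n = *-monoʳ-≤ 2 (≤-pred (toℕ<n j))
    2i+1<2j : 2 * toℕ i + 1 < 2 * toℕ j
    2i+1<2j = from (odd<even⇔ (toℕ i) (toℕ j)) i<j
    2i+1<2n : 2 * toℕ i + 1 < 2 * n
    2i+1<2n = <-≤-trans 2i+1<2j 2j≤2n
  ... | a , a≡2i+1 | b , b≡2j = (a , b) , i<j , a≡2i+1 , b≡2j

  hypEdge-unique : ∀ {i j a b a' b'} → HypEdge i j a b → HypEdge i j a' b' → a ≡ a' × b ≡ b'
  hypEdge-unique (_ , a≡2i+1 , b≡2j) (_ , a'≡2i+1 , b'≡2j) =
    lab-injective (trans a≡2i+1 (sym a'≡2i+1)) , lab-injective (trans b≡2j (sym b'≡2j))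

  hypEdge⇒Γ : ∀ {i j a b} → HypEdge i j a b → ΓEdge n a b
  hypEdge⇒Γ (i<j , a≡2i+1 , b≡2j) = halvesEdge a≡2i+1 b≡2j i<j

  Γ⇒hypEdge : ∀ {a b} → ΓEdge n a b → ∃₂ λ i j → HypEdge i j a b
  Γ⇒hypEdge (suc p , q , _ , p<q , q≤n , a≡2p+1 , b≡2q) =
    fromℕ< p<1+n , fromℕ< q<1+n ,
    subst₂ _<_ (sym (toℕ-fromℕ< p<1+n)) (sym (toℕ-fromℕ< q<1+n)) p<q ,
    trans a≡2p+1 (trans (pred-double p) (cong (λ t → 2 * t + 1) (sym (toℕ-fromℕ< p<1+n)))) ,
    trans b≡2q (cong (2 *_) (sym (toℕ-fromℕ< q<1+n)))
    where
    q<1+n : q < suc n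
    q<1+n = s≤s q≤n
    p<1+n : p < suc n
    p<1+n = s≤s (≤-trans (<⇒≤ p<q) q≤n)

  edgeOf : HypSubset n → Fin (suc n) × Fin (suc n) → Maybe (V × V)
  edgeOf S (i , j) with toℕ i <? toℕ j
  ... | yes i<j = if S i j then just (proj₁ (hypEdge i<j)) else nothing
  ... | no _    = nothing

  indexPairs : List (Fin (suc n) × Fin (suc n))
  indexPairs = cartesianProduct (allFin (suc n)) (allFin (suc n))

  edges : HypSubset n → Edges
  edges S = mapMaybe (edgeOf S) indexPairs

  edgeOf-just : ∀ S {i j a b} → edgeOf S (i , j) ≡ just (a , b) → HypEdge i j a b × S i j ≡ true
  edgeOf-just S {i} {j} edge≡ab with toℕ i <? toℕ j
  ... | yes i<j with S i j
  ...   | true with refl ← edge≡ab = proj₂ (hypEdge i<j) , refl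

  edgeOf-hypEdge : ∀ S {i j a b} → HypEdge i j a b → S i j ≡ true → edgeOf S (i , j) ≡ just (a , b)
  edgeOf-hypEdge S {i} {j} h@(i<j , _) Sij with toℕ i <? toℕ j
  ... | no i≮j = ⊥-elim (i≮j i<j)
  ... | yes i<j' with hypEdge-unique (proj₂ (hypEdge i<j')) h
  ...   | refl , refl rewrite Sij = refl

  ∈edges⇔ : ∀ S {a b} → (a , b) ∈ edges S ⇔ (∃₂ λ i j → HypEdge i j a b × S i j ≡ true)
  ∈edges⇔ S = mk⇔
    (λ ab∈ → let (i , j) , _ , edge≡ab = ∈-mapMaybe⁻ (edgeOf S) indexPairs ab∈ in
             i , j , edgeOf-just S edge≡ab)
    (λ (i , j , h , Sij) → ∈-mapMaybe⁺ (edgeOf S) indexPairs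
                             (∈-cartesianProduct⁺ (∈-allFin i) (∈-allFin j)) (edgeOf-hypEdge S h Sij))

  inter⇔respects : ∀ S x y → InInter S (x , y) ⇔ Respects (edges S) (coord (x , y))
  inter⇔respects S x y = mk⇔
    (λ on {a} {b} ab∈ → let i , j , h@(i<j , _) , Sij = to (∈edges⇔ S) ab∈ in
                to (onHyp⇔ h x y) (on i j i<j Sij))
    (λ respects i j i<j Sij → let (a , b) , h = hypEdge i<j in
                from (onHyp⇔ h x y) (respects (from (∈edges⇔ S) (i , j , h , Sij))))

  pointWith∈ : ∀ S z → Respects (edges S) z → InInter S (pointWith z)
  pointWith∈ S z z-respects = from (inter⇔respects S _ _) λ {a} {b} ab∈ →
    trans (coord-pointWith z a) (trans (z-respects ab∈) (sym (coord-pointWith z b)))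

  blocks : HypSubset n → Partition (2 * n)
  blocks S = component (edges S)

  sameBlock⇔ : ∀ S u v → blocks S u ≡ blocks S v ⇔ (∀ p → InInter S p → coord p u ≡ coord p v)
  sameBlock⇔ S u v = mk⇔
    (λ same (x , y) ip →
      to (sameComponent⇔ (edges S) u v) same (coord (x , y)) (to (inter⇔respects S x y) ip))
    (λ agree → from (sameComponent⇔ (edges S) u v) λ z z-respects →
      trans (sym (coord-pointWith z u))
        (trans (agree (pointWith z) (pointWith∈ S z z-respects)) (coord-pointWith z v)))

  edge⇒Γ : ∀ S {a b} → (a , b) ∈ edges S → ΓEdge n a b
  edge⇒Γ S ab∈ = let _ , _ , h , _ = to (∈edges⇔ S) ab∈ in hypEdge⇒Γ h

  blocks-bond : ∀ S → IsBond (Γ n) (blocks S)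
  blocks-bond S i j k ij ik =
    walk-transport (λ { (inj₁ ab∈) → inj₁ (edge⇒Γ S ab∈)
                      ; (inj₂ ba∈) → inj₂ (edge⇒Γ S ba∈) })
                   (λ e ia → trans ia (component-adj (edges S) e))
                   ij (component-linked (edges S) j k (trans (sym ij) ik))

  blocks-mono : ∀ S T → (∀ p → InInter T p → InInter S p) → blocks S ≤Π blocks T
  blocks-mono S T T⊆S u v same =
    from (sameBlock⇔ T u v) λ p ip → to (sameBlock⇔ S u v) same p (T⊆S p ip)

  blocks-reflect : ∀ S T → blocks S ≤Π blocks T → ∀ p → InInter T p → InInter S p
  blocks-reflect S T refines (x , y) ip = from (inter⇔respects S x y) λ {a} {b} ab∈ →
    to (sameBlock⇔ T a b) (refines a b (component-edge (edges S) ab∈)) (x , y) ip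

  -- a partition g is realised by the hyperplanes whose edge lies inside a block of g
  flatOf : Partition (2 * n) → HypSubset n
  flatOf g i j with toℕ i <? toℕ j
  ... | yes i<j = let (a , b) , _ = hypEdge i<j in does (g a ≟F g b)
  ... | no _    = false

  flatOf⇔ : ∀ g {i j a b} → HypEdge i j a b → flatOf g i j ≡ true ⇔ g a ≡ g b
  flatOf⇔ g {i} {j} h@(i<j , _) with toℕ i <? toℕ j
  ... | no i≮j = ⊥-elim (i≮j i<j)
  ... | yes i<j' with hypEdge-unique (proj₂ (hypEdge i<j')) h
  ...   | refl , refl = does⇔ (g _ ≟F g _)
    where
    does⇔ : ∀ {P : Set} (P? : Dec P) → does P? ≡ true ⇔ P
    does⇔ (yes p) = mk⇔ (λ _ → p) (λ _ → refl)
    does⇔ (no ¬p) = mk⇔ (λ ()) (⊥-elim ∘ ¬p)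

  blocks-flatOf : ∀ g → IsBond (Γ n) g → blocks (flatOf g) ≈Π g
  blocks-flatOf g bond u v = mk⇔
    (λ same → walk-invariant g (λ { _ _ (inj₁ ab∈) → inBlock ab∈
                                  ; _ _ (inj₂ ba∈) → sym (inBlock ba∈) })
                             (component-linked L u v same))
    (λ g-same → walk-invariant (component L) (λ ua ub e → Γ-joins e (trans (sym ua) ub))
                               (bond u u v refl g-same))
    where
    L : Edges
    L = edges (flatOf g)

    inBlock : ∀ {a b} → (a , b) ∈ L → g a ≡ g b
    inBlock ab∈ = let _ , _ , h , s = to (∈edges⇔ (flatOf g)) ab∈ in to (flatOf⇔ g h) s

    Γ-joins : ∀ {a b} → Γ n a b → g a ≡ g b → component L a ≡ component L b
    Γ-joins (inj₁ ab) g-ab = let i , j , h = Γ⇒hypEdge ab in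
      component-edge L (from (∈edges⇔ (flatOf g)) (i , j , h , from (flatOf⇔ g h) g-ab))
    Γ-joins (inj₂ ba) g-ab = sym (Γ-joins (inj₁ ba) (sym g-ab))

  -- the origin lies on every hyperplane, so every set of hyperplanes is a flat
  origin : Point n
  origin = (λ _ → 0ℚ) , (λ _ → 0ℚ)

  origin∈ : ∀ S → InInter S origin
  origin∈ S _ _ _ _ = refl

  iso : PosetIso {Flat n} {BondLattice (Γ n)} _≈L_ _≤L_ _≈Γ_ _≤Γ_
  iso = record
    { to         = λ (S , _) → blocks S , blocks-bond S
    ; to-cong    = λ { {S , _} {T , _} S≈T u v →
                       mk⇔ (blocks-mono S T (λ p → from (S≈T p)) u v)
                           (blocks-mono T S (λ p → to (S≈T p)) u v) }
    ; to-mono    = λ { {S , _} {T , _} → blocks-mono S T }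
    ; to-reflect = λ { {S , _} {T , _} → blocks-reflect S T }
    ; to-surj    = λ (g , bond) → (flatOf g , origin , origin∈ (flatOf g)) , blocks-flatOf g bond
    }

theorem3p1 : (n : ℕ) → 1 ≤ n →
    PosetIso {Flat n} {BondLattice (Γ n)} _≈L_ _≤L_ _≈Γ_ _≤Γ_
    × ((f : Partition (2 * n)) → IsBond (Γ n) f ⇔ MinOddMaxEven f)
theorem3p1 n _ = Arrangement.iso n , bond⇔minOddMaxEven
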